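{- Let $n\ge 2$, let $H_n^4$ be any graph in $\mathscr{H}_n^4$, and let $m$ be an integer with $1\le m\le 2^n$. Then $ex_m(H_n^4)=f(m)$, where, writing $m=\sum_{i=0}^{s}2^{t_i}$ with $t_0>t_1>\cdots>t_s\ge 0$ (binary expansion), $p=\lfloor m/4\rfloor$ and $q=m-4p$, $$f(m)=\begin{cases}\sum_{i=0}^{s}t_i2^{t_i}+\sum_{i=0}^{s}2i\,2^{t_i}+4p & \text{if } 0\le q\le 2,\\ \sum_{i=0}^{s}t_i2^{t_i}+\sum_{i=0}^{s}2i\,2^{t_i}+4p+2 & \text{if } q=3.\end{cases}$$
   Context: The family $\mathscr{H}_n^4$ ($n\ge 2$) of $n$-dimensional $K_4$-hypercubes is defined recursively: $\mathscr{H}_2^4=\{K_4\}$; for $n\ge 3$, a graph belongs to $\mathscr{H}_n^4$ if and only if (up to isomorphism) it is obtained from two vertex-disjoint graphs $G_0,G_1\in\mathscr{H}_{n-1}^4$ (not necessarily isomorphic) by adding an arbitrary perfect matching between $V(G_0)$ and $V(G_1)$. For a graph $G$ and integer $m$, $ex_m(G)$ is the maximum, over all $X\subseteq V(G)$ with $|X|=m$, of the sum of degrees in the induced subgraph $G[X]$, i.e. $\max_{|X|=m}2|E(G[X])|$. -}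

module Defs where

open import Data.Nat using (ℕ; zero; suc; _+_; _*_; _^_; _≤_; _%_; _/_)
open import Data.Bool using (Bool; true; false; _∧_; not; if_then_else_)
open import Data.Fin using (Fin; splitAt; _≟_)
open import Data.Fin.Subset using (Subset; ∣_∣)
open import Data.Vec using (lookup)
open import Data.List using (List; []; _∷_; map; allFin)
open import Data.Nat.ListAction using (sum)
open import Data.List.Relation.Unary.Linked using (Linked)
open import Data.Sum using (_⊎_; inj₁; inj₂)
open import Data.Product using (Σ; _×_; _,_)
open import Function.Bundles using (_↔_; Inverse)
open import Relation.Nullary.Decidable using (⌊_⌋)
open import Relation.Binary.PropositionalEquality using (_≡_)

-- A graph on the vertex set Fin V, given by a Boolean adjacency function.
-- (Simplicity/symmetry is not imposed here; every member of the family
-- H_n^4 defined below is automatically a simple graph.)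
record Graph : Set where
  field
    V   : ℕ
    adj : Fin V → Fin V → Bool
open Graph public

record _≅_ (G H : Graph) : Set where
  field
    φ     : Fin (V G) ↔ Fin (V H)
    preserves : ∀ u v → adj G u v ≡ adj H (Inverse.to φ u) (Inverse.to φ v)

K4 : Graph
K4 = record { V = 4 ; adj = λ u v → not ⌊ u ≟ v ⌋ }

join : (G0 G1 : Graph) → Fin (V G0) ↔ Fin (V G1) → Graph
join G0 G1 σ = record { V = V G0 + V G1 ; adj = a }
  where
  σf = Inverse.to σ
  a' : Fin (V G0) ⊎ Fin (V G1) → Fin (V G0) ⊎ Fin (V G1) → Bool
  a' (inj₁ i) (inj₁ j) = adj G0 i j
  a' (inj₂ i) (inj₂ j) = adj G1 i j
  a' (inj₁ i) (inj₂ j) = ⌊ σf i ≟ j ⌋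
  a' (inj₂ i) (inj₁ j) = ⌊ σf j ≟ i ⌋
  a : Fin (V G0 + V G1) → Fin (V G0 + V G1) → Bool
  a x y = a' (splitAt (V G0) x) (splitAt (V G0) y)

data InH : ℕ → Graph → Set where
  base : ∀ G → G ≅ K4 → InH 2 G
  step : ∀ {n} G0 G1 G → InH n G0 → InH n G1 →
         (σ : Fin (V G0) ↔ Fin (V G1)) → G ≅ join G0 G1 σ → InH (suc n) G

-- Sum of degrees of the induced subgraph G[X] (= 2|E(G[X])| for simple G):
-- the number of ordered pairs (u,v) with u,v ∈ X and u adjacent to v.
degSum : (G : Graph) → Subset (V G) → ℕ
degSum G X = sum (map (λ u → sum (map (λ v →
  if lookup X u ∧ lookup X v ∧ adj G u v then 1 else 0) (allFin (V G))))
  (allFin (V G)))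

IsExm : (G : Graph) → ℕ → ℕ → Set
IsExm G m e = (Σ (Subset (V G)) λ X → (∣ X ∣ ≡ m) × (degSum G X ≡ e))
            × (∀ (X : Subset (V G)) → ∣ X ∣ ≡ m → degSum G X ≤ e)

sumPow : List ℕ → ℕ
sumPow []       = 0
sumPow (t ∷ ts) = 2 ^ t + sumPow ts

fSum : ℕ → List ℕ → ℕ
fSum k []       = 0
fSum k (t ∷ ts) = t * 2 ^ t + 2 * k * 2 ^ t + fSum (suc k) ts

extra : ℕ → ℕ
extra 3 = 2
extra _ = 0

f : ℕ → List ℕ → ℕ
f m ts = fSum 0 ts + 4 * (m / 4) + extra (m % 4)

Decreasing : List ℕ → Set
Decreasing = Linked (λ a b → b Data.Nat.< a)

module Submission where

-- Every G ∈ H_n^4 is optimal in the following sense: an m-vertex set induces degree sum at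
-- most ex n m = 2 · edges n m + surplus m, and every m ≤ 2^n attains it. Here edges is the
-- edge-isoperimetric profile of the n-cube and surplus counts the diagonals of the K4-blocks.
-- Optimality survives the matching construction: an m-set splits into an a-set and a b-set
-- of the two halves, joined by at most min(a,b) matching edges, and
-- ex n a + ex n b + 2 min(a,b) ≤ ex (n+1) (a+b) by the cube's merging inequality and the
-- superadditivity of surplus; a full first half together with an optimal set of the second
-- half attains the bound. Finally ex n m is f(m) read off the binary expansion of m.

open import Defs
open import Data.Bool using (Bool; true; false; T; _∧_; if_then_else_)
open import Data.Bool.Properties using (∧-assoc; ∧-comm)
open import Data.Fin using (Fin; zero; suc; toℕ; _↑ˡ_; _↑ʳ_; splitAt)
open import Data.Fin.Permutation using (↔⇒≡; inverseˡ)
open import Data.Fin.Properties using (_≟_; splitAt-↑ˡ; splitAt-↑ʳ)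
  renaming (suc-injective to Fin-suc-injective)
open import Data.Fin.Subset using (Subset; ∣_∣)
open import Data.List using (List; []; _∷_)
import Data.List as List
open import Data.List.Properties using (map-tabulate)
open import Data.List.Relation.Unary.Linked using (_∷_)
import Data.List.Relation.Unary.Linked as Linked
open import Data.Nat hiding (_≟_)
open import Data.Nat.DivMod using (m/n≡1+[m∸n]/n; [m+n]%n≡m%n)
open import Data.Nat.ListAction using (sum)
open import Data.Nat.Properties hiding (_≟_)
open import Data.Nat.Tactic.RingSolver using (solve-∀)
open import Data.Product using (∃-syntax; _×_; _,_)
open import Data.Sum using (_⊎_; inj₁; inj₂; [_,_]′)
open import Data.Vec using (Vec; []; _∷_; lookup; tabulate)
open import Data.Vec.Properties using (lookup∘tabulate)
open import Function using (_∘_)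
open import Function.Bundles using (_↔_; Inverse)
open import Relation.Nullary using (yes; no; contradiction)
open import Relation.Nullary.Decidable using (⌊_⌋)
open import Relation.Binary.PropositionalEquality
open import Algebra.Properties.CommutativeMonoid.Sum +-0-commutativeMonoid
  using (sum-syntax; sum-cong-≗; ∑-distrib-+; ∑-comm; sum-permute; sum-replicate-zero)
  renaming (sum to ∑)

-- Hypercube edge counts

2^suc : ∀ k → 2 ^ suc k ≡ 2 ^ k + 2 ^ k
2^suc k = cong (2 ^ k +_) (+-identityʳ (2 ^ k))

-- edges k m counts the edges of the k-cube induced by its first m vertices in
-- binary order; by Harper's theorem this is the edge-isoperimetric profile of the cube.
edges : ℕ → ℕ → ℕ
edges zero    m = 0
edges (suc k) m with m ≤? 2 ^ k
... | yes _ = edges k m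
... | no  _ = edges k (2 ^ k) + edges k (m ∸ 2 ^ k) + (m ∸ 2 ^ k)

edges-low : ∀ k {m} → m ≤ 2 ^ k → edges (suc k) m ≡ edges k m
edges-low k {m} m≤ with m ≤? 2 ^ k
... | yes _ = refl
... | no m≰ = contradiction m≤ m≰

edges-zero : ∀ k → edges k 0 ≡ 0
edges-zero zero    = refl
edges-zero (suc k) = trans (edges-low k z≤n) (edges-zero k)

edges-high : ∀ k {x} → x ≤ 2 ^ k → edges (suc k) (2 ^ k + x) ≡ edges k (2 ^ k) + edges k x + x
edges-high k {zero} _ rewrite +-identityʳ (2 ^ k) | edges-zero k =
  trans (edges-low k ≤-refl) (sym (trans (+-identityʳ _) (+-identityʳ _)))
edges-high k {suc x} _ with 2 ^ k + suc x ≤? 2 ^ k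
... | yes ≤2^k = contradiction ≤2^k (m+1+n≰m (2 ^ k))
... | no  _    rewrite m+n∸m≡n (2 ^ k) (suc x) = refl

edges-full : ∀ k → edges (suc k) (2 ^ suc k) ≡ edges k (2 ^ k) + edges k (2 ^ k) + 2 ^ k
edges-full k = trans (cong (edges (suc k)) (2^suc k)) (edges-high k ≤-refl)

edges-lift : ∀ {k K m} → k ≤ K → m ≤ 2 ^ k → edges K m ≡ edges k m
edges-lift {K = zero}  z≤n       _  = refl
edges-lift {K = suc K} k≤1+K m≤ with m≤n⇒m<n∨m≡n k≤1+K
... | inj₁ k<1+K = trans (edges-low K (≤-trans m≤ (^-monoʳ-≤ 2 (s≤s⁻¹ k<1+K)))) (edges-lift (s≤s⁻¹ k<1+K) m≤)
... | inj₂ refl = refl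

edges-full-closed : ∀ k → 2 * edges k (2 ^ k) ≡ k * 2 ^ k
edges-full-closed zero    = refl
edges-full-closed (suc k) = begin
  2 * edges (suc k) (2 ^ suc k)  ≡⟨ cong (2 *_) (edges-full k) ⟩
  2 * (A + A + K)                ≡⟨ regroup A K ⟩
  2 * (2 * A) + 2 * K            ≡⟨ cong (λ x → 2 * x + 2 * K) (edges-full-closed k) ⟩
  2 * (k * K) + 2 * K            ≡⟨ regroup′ k K ⟩
  suc k * (2 * K)                ∎
  where
  open ≡-Reasoning
  K A : ℕ
  K = 2 ^ k
  A = edges k K
  regroup : ∀ A K → 2 * (A + A + K) ≡ 2 * (2 * A) + 2 * K
  regroup = solve-∀
  regroup′ : ∀ k K → 2 * (k * K) + 2 * K ≡ suc k * (2 * K)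
  regroup′ = solve-∀

halve : ∀ K {a} → a ≤ K + K → a < K ⊎ ∃[ a′ ] a′ ≤ K × a ≡ K + a′
halve K {a} a≤ with a <? K
... | yes a<K = inj₁ a<K
... | no  a≮K = inj₂ (a ∸ K , ∸-≤ , sym (m+[n∸m]≡n (≮⇒≥ a≮K)))
  where
  ∸-≤ : a ∸ K ≤ K
  ∸-≤ = subst (a ∸ K ≤_) (m+n∸m≡n K K) (∸-monoˡ-≤ K a≤)

-- Merging: an a-set and a b-set placed in the two halves of the (k+1)-cube gain
-- min(a,b) matching edges. Exchanging: when x + y overflows 2^k, completing one of
-- the two sets to a full k-cube loses no edges.
mutual
  edges-merge : ∀ k {a b} → a ≤ 2 ^ k → b ≤ 2 ^ k →
                edges k a + edges k b + a ⊓ b ≤ edges (suc k) (a + b)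
  edges-merge k {a} {b} a≤ b≤ with ≤-total b a
  ... | inj₁ b≤a rewrite m≥n⇒m⊓n≡n b≤a = edges-merge-≥ k b≤a a≤
  ... | inj₂ a≤b rewrite m≤n⇒m⊓n≡m a≤b | +-comm (edges k a) (edges k b) | +-comm a b =
    edges-merge-≥ k a≤b b≤

  edges-exchange : ∀ k {x y c} → x ≤ 2 ^ k → y ≤ 2 ^ k → x + y ≡ 2 ^ k + c →
                   edges k x + edges k y ≤ edges k (2 ^ k) + edges k c
  edges-exchange k {x} {y} x≤ y≤ x+y≡ with ≤-total y x
  ... | inj₁ y≤x = edges-exchange-≥ k y≤x x≤ x+y≡
  ... | inj₂ x≤y rewrite +-comm (edges k x) (edges k y) =
    edges-exchange-≥ k x≤y y≤ (trans (+-comm y x) x+y≡)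

  edges-merge-≥ : ∀ k {a b} → b ≤ a → a ≤ 2 ^ k → edges k a + edges k b + b ≤ edges (suc k) (a + b)
  edges-merge-≥ zero {0} {0} _ _ = z≤n
  edges-merge-≥ zero {1} {0} _ _ = z≤n
  edges-merge-≥ zero {1} {1} _ _ = ≤-refl
  edges-merge-≥ zero {1} {suc (suc _)} (s≤s ()) _
  edges-merge-≥ zero {suc (suc _)} _ (s≤s ())
  edges-merge-≥ (suc k) {a} {b} b≤a a≤ with halve (2 ^ k) (subst (a ≤_) (2^suc k) a≤)
  ... | inj₁ a<K = edges-merge-low k b≤a a<K
  ... | inj₂ (a′ , a′≤ , refl) with halve (2 ^ k) (≤-trans b≤a (subst (a ≤_) (2^suc k) a≤))
  ...   | inj₁ b<K = edges-merge-straddle k a′≤ b<K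
  ...   | inj₂ (b′ , b′≤ , refl) = edges-merge-high k (+-cancelˡ-≤ (2 ^ k) _ _ b≤a) a′≤ b′≤

  edges-exchange-≥ : ∀ k {x y c} → y ≤ x → x ≤ 2 ^ k → x + y ≡ 2 ^ k + c →
                     edges k x + edges k y ≤ edges k (2 ^ k) + edges k c
  edges-exchange-≥ zero _ _ _ = z≤n
  edges-exchange-≥ (suc k) {x} {y} {c} y≤x x≤ x+y≡ with halve (2 ^ k) (subst (x ≤_) (2^suc k) x≤)
  ... | inj₁ x<K = contradiction (subst (_≤ x + y) (2^suc k) (subst (2 ^ suc k ≤_) (sym x+y≡) (m≤m+n _ c)))
                                 (<⇒≱ (+-mono-< x<K (≤-<-trans y≤x x<K)))
  ... | inj₂ (x′ , x′≤ , refl) with halve (2 ^ k) (≤-trans y≤x (subst (x ≤_) (2^suc k) x≤))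
  ...   | inj₁ y<K = edges-exchange-straddle k x′≤ y<K x+y≡
  ...   | inj₂ (y′ , y′≤ , refl) = edges-exchange-high k (+-cancelˡ-≤ (2 ^ k) _ _ y≤x) x′≤ y′≤ x+y≡

  edges-merge-low : ∀ k {a b} → b ≤ a → a < 2 ^ k →
              edges (suc k) a + edges (suc k) b + b ≤ edges (suc (suc k)) (a + b)
  edges-merge-low k {a} {b} b≤a a<K = begin
    edges (suc k) a + edges (suc k) b + b ≡⟨ cong₂ (λ u v → u + v + b) (edges-low k a≤) (edges-low k b≤) ⟩
    edges k a + edges k b + b             ≤⟨ edges-merge-≥ k b≤a a≤ ⟩
    edges (suc k) (a + b)                 ≡⟨ edges-low (suc k) a+b≤ ⟨
    edges (suc (suc k)) (a + b)           ∎
    where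
    open ≤-Reasoning
    a≤ : a ≤ 2 ^ k
    a≤ = <⇒≤ a<K
    b≤ : b ≤ 2 ^ k
    b≤ = ≤-trans b≤a a≤
    a+b≤ : a + b ≤ 2 ^ suc k
    a+b≤ = subst (a + b ≤_) (sym (2^suc k)) (+-mono-≤ a≤ b≤)

  edges-merge-straddle : ∀ k {a′ b} → a′ ≤ 2 ^ k → b < 2 ^ k →
                   edges (suc k) (2 ^ k + a′) + edges (suc k) b + b ≤ edges (suc (suc k)) (2 ^ k + a′ + b)
  edges-merge-straddle k {a′} {b} a′≤ b<K with a′ + b ≤? 2 ^ k
  ... | yes a′+b≤ = begin
    edges (suc k) (K + a′) + edges (suc k) b + b ≡⟨ cong₂ (λ u v → u + v + b) (edges-high k a′≤) (edges-low k b≤) ⟩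
    A + E a′ + a′ + E b + b                      ≡⟨ regroup A (E a′) a′ (E b) b ⟩
    A + (E a′ + E b) + (a′ + b)                  ≤⟨ +-monoˡ-≤ (a′ + b) (+-monoʳ-≤ A superadditive) ⟩
    A + E (a′ + b) + (a′ + b)                    ≡⟨ edges-high k a′+b≤ ⟨
    edges (suc k) (K + (a′ + b))                 ≡⟨ cong (edges (suc k)) (+-assoc K a′ b) ⟨
    edges (suc k) (K + a′ + b)                   ≡⟨ edges-low (suc k) K+a′+b≤ ⟨
    edges (suc (suc k)) (K + a′ + b)             ∎
    where
    open ≤-Reasoning
    K A : ℕ
    K = 2 ^ k
    A = edges k K
    E : ℕ → ℕ
    E = edges k
    b≤ : b ≤ K
    b≤ = <⇒≤ b<K
    superadditive : E a′ + E b ≤ E (a′ + b)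
    superadditive = subst (E a′ + E b ≤_) (edges-low k a′+b≤)
                          (≤-trans (m≤m+n (E a′ + E b) (a′ ⊓ b)) (edges-merge k a′≤ b≤))
    K+a′+b≤ : K + a′ + b ≤ 2 ^ suc k
    K+a′+b≤ = subst₂ _≤_ (sym (+-assoc K a′ b)) (sym (2^suc k)) (+-monoʳ-≤ K a′+b≤)
    regroup : ∀ A x a y b → A + x + a + y + b ≡ A + (x + y) + (a + b)
    regroup = solve-∀
  ... | no a′+b≰ = begin
    edges (suc k) (K + a′) + edges (suc k) b + b ≡⟨ cong₂ (λ u v → u + v + b) (edges-high k a′≤) (edges-low k b≤) ⟩
    A + E a′ + a′ + E b + b                      ≡⟨ regroup A (E a′) a′ (E b) b ⟩
    A + (E a′ + E b) + (a′ + b)                  ≤⟨ +-monoˡ-≤ (a′ + b) (+-monoʳ-≤ A (edges-exchange k a′≤ b≤ a′+b≡)) ⟩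
    A + (A + E c) + (a′ + b)                     ≡⟨ cong (A + (A + E c) +_) a′+b≡ ⟩
    A + (A + E c) + (K + c)                      ≡⟨ regroup′ A (E c) K c ⟩
    A + A + K + E c + c                          ≡⟨ cong₂ (λ u v → u + v + c) (edges-full k) (edges-low k c≤) ⟨
    edges (suc k) (2 ^ suc k) + edges (suc k) c + c ≡⟨ edges-high (suc k) (≤-trans c≤ (m≤m+n K _)) ⟨
    edges (suc (suc k)) (2 ^ suc k + c)          ≡⟨ cong (edges (suc (suc k))) K+a′+b≡ ⟨
    edges (suc (suc k)) (K + a′ + b)             ∎
    where
    open ≤-Reasoning
    K A : ℕ
    K = 2 ^ k
    A = edges k K
    E : ℕ → ℕ
    E = edges k
    b≤ : b ≤ K
    b≤ = <⇒≤ b<K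
    c : ℕ
    c = a′ + b ∸ K
    a′+b≡ : a′ + b ≡ K + c
    a′+b≡ = sym (m+[n∸m]≡n (<⇒≤ (≰⇒> a′+b≰)))
    c≤ : c ≤ K
    c≤ = ≤-trans (+-cancelˡ-≤ K _ _ (subst₂ _≤_ a′+b≡ (+-comm a′ K) (+-monoʳ-≤ a′ b≤))) a′≤
    K+a′+b≡ : K + a′ + b ≡ 2 ^ suc k + c
    K+a′+b≡ = trans (+-assoc K a′ b) (trans (cong (K +_) a′+b≡) (trans (sym (+-assoc K K c)) (cong (_+ c) (sym (2^suc k)))))
    regroup : ∀ A x a y b → A + x + a + y + b ≡ A + (x + y) + (a + b)
    regroup = solve-∀
    regroup′ : ∀ A e K c → A + (A + e) + (K + c) ≡ A + A + K + e + c
    regroup′ = solve-∀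

  edges-merge-high : ∀ k {a′ b′} → b′ ≤ a′ → a′ ≤ 2 ^ k → b′ ≤ 2 ^ k →
               edges (suc k) (2 ^ k + a′) + edges (suc k) (2 ^ k + b′) + (2 ^ k + b′)
                 ≤ edges (suc (suc k)) (2 ^ k + a′ + (2 ^ k + b′))
  edges-merge-high k {a′} {b′} b′≤a′ a′≤ b′≤ = begin
    edges (suc k) (K + a′) + edges (suc k) (K + b′) + (K + b′)
      ≡⟨ cong₂ (λ u v → u + v + (K + b′)) (edges-high k a′≤) (edges-high k b′≤) ⟩
    A + E a′ + a′ + (A + E b′ + b′) + (K + b′)   ≡⟨ regroup A (E a′) a′ (E b′) b′ K ⟩
    A + A + K + (E a′ + E b′ + b′) + (a′ + b′)   ≤⟨ +-monoˡ-≤ (a′ + b′) (+-monoʳ-≤ (A + A + K) (edges-merge-≥ k b′≤a′ a′≤)) ⟩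
    A + A + K + edges (suc k) (a′ + b′) + (a′ + b′) ≡⟨ cong (λ u → u + edges (suc k) (a′ + b′) + (a′ + b′)) (edges-full k) ⟨
    edges (suc k) (2 ^ suc k) + edges (suc k) (a′ + b′) + (a′ + b′)
      ≡⟨ edges-high (suc k) (subst (a′ + b′ ≤_) (sym (2^suc k)) (+-mono-≤ a′≤ b′≤)) ⟨
    edges (suc (suc k)) (2 ^ suc k + (a′ + b′))  ≡⟨ cong (λ u → edges (suc (suc k)) (u + (a′ + b′))) (2^suc k) ⟩
    edges (suc (suc k)) (K + K + (a′ + b′))      ≡⟨ cong (edges (suc (suc k))) (interchange K a′ b′) ⟩
    edges (suc (suc k)) (K + a′ + (K + b′))      ∎
    where
    open ≤-Reasoning
    K A : ℕ
    K = 2 ^ k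
    A = edges k K
    E : ℕ → ℕ
    E = edges k
    regroup : ∀ A x a y b K → A + x + a + (A + y + b) + (K + b) ≡ A + A + K + (x + y + b) + (a + b)
    regroup = solve-∀
    interchange : ∀ K a b → K + K + (a + b) ≡ K + a + (K + b)
    interchange = solve-∀

  edges-exchange-straddle : ∀ k {x′ y c} → x′ ≤ 2 ^ k → y < 2 ^ k → 2 ^ k + x′ + y ≡ 2 ^ suc k + c →
                      edges (suc k) (2 ^ k + x′) + edges (suc k) y ≤ edges (suc k) (2 ^ suc k) + edges (suc k) c
  edges-exchange-straddle k {x′} {y} {c} x′≤ y<K x+y≡ = begin
    edges (suc k) (K + x′) + edges (suc k) y ≡⟨ cong₂ _+_ (edges-high k x′≤) (edges-low k y≤) ⟩
    A + E x′ + x′ + E y                      ≡⟨ regroup A (E x′) x′ (E y) ⟩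
    A + (E x′ + E y) + x′                    ≤⟨ +-mono-≤ (+-monoʳ-≤ A (edges-exchange k x′≤ y≤ x′+y≡)) x′≤ ⟩
    A + (A + E c) + K                        ≡⟨ regroup′ A (E c) K ⟩
    A + A + K + E c                          ≡⟨ cong₂ _+_ (edges-full k) (edges-low k c≤) ⟨
    edges (suc k) (2 ^ suc k) + edges (suc k) c ∎
    where
    open ≤-Reasoning
    K A : ℕ
    K = 2 ^ k
    A = edges k K
    E : ℕ → ℕ
    E = edges k
    y≤ : y ≤ K
    y≤ = <⇒≤ y<K
    x′+y≡ : x′ + y ≡ K + c
    x′+y≡ = +-cancelˡ-≡ K _ _ (begin-equality
      K + (x′ + y)   ≡⟨ +-assoc K x′ y ⟨
      K + x′ + y     ≡⟨ x+y≡ ⟩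
      2 ^ suc k + c  ≡⟨ cong (_+ c) (2^suc k) ⟩
      K + K + c      ≡⟨ +-assoc K K c ⟩
      K + (K + c)    ∎)
    c≤ : c ≤ K
    c≤ = ≤-trans (+-cancelˡ-≤ K _ _ (subst₂ _≤_ x′+y≡ (+-comm x′ K) (+-monoʳ-≤ x′ y≤))) x′≤
    regroup : ∀ A x a y → A + x + a + y ≡ A + (x + y) + a
    regroup = solve-∀
    regroup′ : ∀ A e K → A + (A + e) + K ≡ A + A + K + e
    regroup′ = solve-∀

  edges-exchange-high : ∀ k {x′ y′ c} → y′ ≤ x′ → x′ ≤ 2 ^ k → y′ ≤ 2 ^ k → 2 ^ k + x′ + (2 ^ k + y′) ≡ 2 ^ suc k + c →
                  edges (suc k) (2 ^ k + x′) + edges (suc k) (2 ^ k + y′) ≤ edges (suc k) (2 ^ suc k) + edges (suc k) c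
  edges-exchange-high k {x′} {y′} {c} y′≤x′ x′≤ y′≤ x+y≡ = begin
    edges (suc k) (K + x′) + edges (suc k) (K + y′) ≡⟨ cong₂ _+_ (edges-high k x′≤) (edges-high k y′≤) ⟩
    A + E x′ + x′ + (A + E y′ + y′)              ≡⟨ regroup A (E x′) x′ (E y′) y′ ⟩
    A + A + (E x′ + E y′ + y′) + x′              ≤⟨ +-mono-≤ (+-monoʳ-≤ (A + A) (edges-merge-≥ k y′≤x′ x′≤)) x′≤ ⟩
    A + A + edges (suc k) (x′ + y′) + K          ≡⟨ regroup′ A (edges (suc k) (x′ + y′)) K ⟩
    A + A + K + edges (suc k) (x′ + y′)          ≡⟨ cong₂ _+_ (edges-full k) (cong (edges (suc k)) (sym x′+y′≡c)) ⟨
    edges (suc k) (2 ^ suc k) + edges (suc k) c  ∎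
    where
    open ≤-Reasoning
    K A : ℕ
    K = 2 ^ k
    A = edges k K
    E : ℕ → ℕ
    E = edges k
    interchange : ∀ K a b → K + K + (a + b) ≡ K + a + (K + b)
    interchange = solve-∀
    x′+y′≡c : x′ + y′ ≡ c
    x′+y′≡c = +-cancelˡ-≡ (K + K) _ _ (trans (interchange K x′ y′) (trans x+y≡ (cong (_+ c) (2^suc k))))
    regroup : ∀ A x a y b → A + x + a + (A + y + b) ≡ A + A + (x + y + b) + a
    regroup = solve-∀
    regroup′ : ∀ A e K → A + A + e + K ≡ A + A + K + e
    regroup′ = solve-∀

-- The K4 surplus and the bound ex

-- The degree-sum surplus of K4-blocks over 2-cubes: a full block gains its two
-- diagonals (+4), a block of three vertices one of them (+2).
surplus : ℕ → ℕ
surplus 0 = 0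
surplus 1 = 0
surplus 2 = 0
surplus 3 = 2
surplus (suc (suc (suc (suc m)))) = 4 + surplus m

surplus-by-div-mod : ∀ m → 4 * (m / 4) + extra (m % 4) ≡ surplus m
surplus-by-div-mod 0 = refl
surplus-by-div-mod 1 = refl
surplus-by-div-mod 2 = refl
surplus-by-div-mod 3 = refl
surplus-by-div-mod (suc (suc (suc (suc m)))) = begin
  4 * ((4 + m) / 4) + extra ((4 + m) % 4) ≡⟨ cong₂ (λ q r → 4 * q + extra r) [4+m]/4≡ [4+m]%4≡ ⟩
  4 * suc (m / 4) + extra (m % 4)         ≡⟨ cong (_+ extra (m % 4)) (*-suc 4 (m / 4)) ⟩
  4 + 4 * (m / 4) + extra (m % 4)         ≡⟨ +-assoc 4 (4 * (m / 4)) (extra (m % 4)) ⟩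
  4 + (4 * (m / 4) + extra (m % 4))       ≡⟨ cong (4 +_) (surplus-by-div-mod m) ⟩
  4 + surplus m                           ∎
  where
  open ≡-Reasoning
  [4+m]/4≡ : (4 + m) / 4 ≡ suc (m / 4)
  [4+m]/4≡ = m/n≡1+[m∸n]/n {4 + m} {4} (s≤s (s≤s (s≤s (s≤s z≤n))))
  [4+m]%4≡ : (4 + m) % 4 ≡ m % 4
  [4+m]%4≡ = trans (cong (_% 4) (+-comm 4 m)) ([m+n]%n≡m%n m 4)

surplus-+-*4 : ∀ j x → surplus (j * 4 + x) ≡ j * 4 + surplus x
surplus-+-*4 zero    x = refl
surplus-+-*4 (suc j) x = cong (4 +_) (surplus-+-*4 j x)

surplus-2^+ : ∀ n → 2 ≤ n → ∀ b → surplus (2 ^ n + b) ≡ 2 ^ n + surplus b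
surplus-2^+ (suc (suc k)) (s≤s (s≤s z≤n)) b =
  subst (λ P → surplus (P + b) ≡ P + surplus b) (sym (2*[2*K]≡K*4 (2 ^ k))) (surplus-+-*4 (2 ^ k) b)
  where
  2*[2*K]≡K*4 : ∀ K → 2 * (2 * K) ≡ K * 4
  2*[2*K]≡K*4 = solve-∀

≤-numeral : ∀ {m n} → {T (m ≤ᵇ n)} → m ≤ n
≤-numeral {m} {n} {m≤ᵇn} = ≤ᵇ⇒≤ m n m≤ᵇn

surplus-superadditive : ∀ a b → surplus a + surplus b ≤ surplus (a + b)
surplus-superadditive (suc (suc (suc (suc a)))) b = +-monoʳ-≤ 4 (surplus-superadditive a b)
surplus-superadditive 0 b = ≤-refl
surplus-superadditive 1 (suc (suc (suc (suc b)))) = +-monoʳ-≤ 4 (surplus-superadditive 1 b)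
surplus-superadditive 2 (suc (suc (suc (suc b)))) = +-monoʳ-≤ 4 (surplus-superadditive 2 b)
surplus-superadditive 3 (suc (suc (suc (suc b)))) = +-monoʳ-≤ 4 (surplus-superadditive 3 b)
surplus-superadditive 1 0 = ≤-numeral
surplus-superadditive 1 1 = ≤-numeral
surplus-superadditive 1 2 = ≤-numeral
surplus-superadditive 1 3 = ≤-numeral
surplus-superadditive 2 0 = ≤-numeral
surplus-superadditive 2 1 = ≤-numeral
surplus-superadditive 2 2 = ≤-numeral
surplus-superadditive 2 3 = ≤-numeral
surplus-superadditive 3 0 = ≤-numeral
surplus-superadditive 3 1 = ≤-numeral
surplus-superadditive 3 2 = ≤-numeral
surplus-superadditive 3 3 = ≤-numeral

ex : ℕ → ℕ → ℕ
ex n m = 2 * edges n m + surplus m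

ex-low : ∀ n {m} → m ≤ 2 ^ n → ex (suc n) m ≡ ex n m
ex-low n {m} m≤ = cong (λ e → 2 * e + surplus m) (edges-low n m≤)

ex-merge : ∀ n {a b} → a ≤ 2 ^ n → b ≤ 2 ^ n → ex n a + ex n b + 2 * (a ⊓ b) ≤ ex (suc n) (a + b)
ex-merge n {a} {b} a≤ b≤ = begin
  ex n a + ex n b + 2 * (a ⊓ b)
    ≡⟨ regroup (edges n a) (surplus a) (edges n b) (surplus b) (a ⊓ b) ⟩
  2 * (edges n a + edges n b + a ⊓ b) + (surplus a + surplus b)
    ≤⟨ +-mono-≤ (*-monoʳ-≤ 2 (edges-merge n a≤ b≤)) (surplus-superadditive a b) ⟩
  ex (suc n) (a + b) ∎
  where
  open ≤-Reasoning
  regroup : ∀ x s y t z → 2 * x + s + (2 * y + t) + 2 * z ≡ 2 * (x + y + z) + (s + t)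
  regroup = solve-∀

-- Only here is n ≥ 2 needed: 4 divides 2^n, so the full first half adds its whole size to the surplus.
ex-high : ∀ n {b} → 2 ≤ n → b ≤ 2 ^ n → ex (suc n) (2 ^ n + b) ≡ ex n (2 ^ n) + ex n b + 2 * b
ex-high n {b} 2≤n b≤ = begin
  2 * edges (suc n) (P + b) + surplus (P + b)   ≡⟨ cong₂ (λ e s → 2 * e + s) (edges-high n b≤) (surplus-2^+ n 2≤n b) ⟩
  2 * (edges n P + edges n b + b) + (P + surplus b) ≡⟨ regroup (edges n P) (edges n b) b P (surplus b) ⟩
  2 * edges n P + P + ex n b + 2 * b            ≡⟨ cong (λ s → 2 * edges n P + s + ex n b + 2 * b) surplus-P ⟨
  ex n P + ex n b + 2 * b                       ∎
  where
  open ≡-Reasoning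
  P : ℕ
  P = 2 ^ n
  surplus-P : surplus P ≡ P
  surplus-P = trans (cong surplus (sym (+-identityʳ P))) (trans (surplus-2^+ n 2≤n 0) (+-identityʳ P))
  regroup : ∀ e f b P s → 2 * (e + f + b) + (P + s) ≡ 2 * e + P + (2 * f + s) + 2 * b
  regroup = solve-∀

-- The bound in the paper's binary-expansion form

fSum-suc : ∀ k ts → fSum (suc k) ts ≡ fSum k ts + 2 * sumPow ts
fSum-suc k []       = refl
fSum-suc k (t ∷ ts) = trans (cong (t * 2 ^ t + 2 * suc k * 2 ^ t +_) (fSum-suc (suc k) ts))
                            (regroup (t * 2 ^ t) (2 ^ t) k (fSum (suc k) ts) (sumPow ts))
  where
  regroup : ∀ x p k s m → x + 2 * suc k * p + (s + 2 * m) ≡ x + 2 * k * p + s + 2 * (p + m)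
  regroup = solve-∀

sumPow-tail< : ∀ t ts → Decreasing (t ∷ ts) → sumPow ts < 2 ^ t
sumPow-tail< t []        _             = m^n>0 2 t
sumPow-tail< t (t′ ∷ ts) (t′<t ∷ ts↓) = <-≤-trans (+-monoʳ-< (2 ^ t′) (sumPow-tail< t′ ts ts↓))
                                                  (subst (_≤ 2 ^ t) (2^suc t′) (^-monoʳ-≤ 2 t′<t))

fSum≡2*edges : ∀ K ts → Decreasing ts → sumPow ts < 2 ^ K → fSum 0 ts ≡ 2 * edges K (sumPow ts)
fSum≡2*edges K []       _   _ = sym (cong (2 *_) (edges-zero K))
fSum≡2*edges K (t ∷ ts) ts↓ m< = begin
  t * 2 ^ t + 0 + fSum 1 ts                       ≡⟨ cong (t * 2 ^ t + 0 +_) (fSum-suc 0 ts) ⟩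
  t * 2 ^ t + 0 + (fSum 0 ts + 2 * m′)            ≡⟨ cong₂ (λ x y → x + 0 + (y + 2 * m′)) (edges-full-closed t) (sym tail≡) ⟨
  2 * edges t (2 ^ t) + 0 + (2 * edges t m′ + 2 * m′) ≡⟨ regroup (edges t (2 ^ t)) (edges t m′) m′ ⟩
  2 * (edges t (2 ^ t) + edges t m′ + m′)         ≡⟨ cong (2 *_) (edges-high t (<⇒≤ m′<)) ⟨
  2 * edges (suc t) (2 ^ t + m′)                  ≡⟨ cong (2 *_) (edges-lift t<K m≤) ⟨
  2 * edges K (2 ^ t + m′)                        ∎
  where
  open ≡-Reasoning
  m′ : ℕ
  m′ = sumPow ts
  m′< : m′ < 2 ^ t
  m′< = sumPow-tail< t ts ts↓
  t<K : t < K
  t<K = ≰⇒> (λ K≤t → <⇒≱ m< (≤-trans (^-monoʳ-≤ 2 K≤t) (m≤m+n (2 ^ t) m′)))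
  m≤ : 2 ^ t + m′ ≤ 2 ^ suc t
  m≤ = subst (2 ^ t + m′ ≤_) (sym (2^suc t)) (+-monoʳ-≤ (2 ^ t) (<⇒≤ m′<))
  tail≡ : fSum 0 ts ≡ 2 * edges t m′
  tail≡ = trans (fSum≡2*edges K ts (Linked.tail ts↓) (≤-<-trans (m≤n+m m′ (2 ^ t)) m<)) (cong (2 *_) (edges-lift (<⇒≤ t<K) (<⇒≤ m′<)))
  regroup : ∀ A e m → 2 * A + 0 + (2 * e + 2 * m) ≡ 2 * (A + e + m)
  regroup = solve-∀

f≡ex : ∀ n {m ts} → Decreasing ts → sumPow ts ≡ m → m ≤ 2 ^ n → f m ts ≡ ex n m
f≡ex n {m} {ts} ts↓ refl m≤ = begin
  fSum 0 ts + 4 * (m / 4) + extra (m % 4)   ≡⟨ +-assoc (fSum 0 ts) _ _ ⟩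
  fSum 0 ts + (4 * (m / 4) + extra (m % 4)) ≡⟨ cong₂ _+_ (fSum≡2*edges (suc n) ts ts↓ m<) (surplus-by-div-mod m) ⟩
  ex (suc n) m                              ≡⟨ ex-low n m≤ ⟩
  ex n m                                    ∎
  where
  open ≡-Reasoning
  m< : m < 2 ^ suc n
  m< = subst (m <_) (sym (2^suc n)) (≤-<-trans m≤ (m<m+n (2 ^ n) (m^n>0 2 n)))

-- Degree sums of induced subgraphs

ind : Bool → ℕ
ind b = if b then 1 else 0

ind-∧ : ∀ x y → ind (x ∧ y) ≡ ind x * ind y
ind-∧ true  y = sym (+-identityʳ (ind y))
ind-∧ false y = refl

ind-∧-≤ˡ : ∀ x y → ind (x ∧ y) ≤ ind x
ind-∧-≤ˡ true  true  = ≤-refl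
ind-∧-≤ˡ true  false = z≤n
ind-∧-≤ˡ false y     = z≤n

ind-∧-≤ʳ : ∀ x y → ind (x ∧ y) ≤ ind y
ind-∧-≤ʳ true  y = ≤-refl
ind-∧-≤ʳ false y = z≤n

ind-∧-swap : ∀ x y z → ind (x ∧ y ∧ z) ≡ ind (y ∧ x ∧ z)
ind-∧-swap x y z = cong ind (trans (sym (∧-assoc x y z)) (trans (cong (_∧ z) (∧-comm x y)) (∧-assoc y x z)))

ind≤1 : ∀ x → ind x ≤ 1
ind≤1 true  = ≤-refl
ind≤1 false = z≤n

∑-mono : ∀ {n} {g h : Fin n → ℕ} → (∀ i → g i ≤ h i) → ∑ g ≤ ∑ h
∑-mono {zero}  _   = z≤n
∑-mono {suc n} g≤h = +-mono-≤ (g≤h zero) (∑-mono (g≤h ∘ suc))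

∑-split : ∀ m n (g : Fin (m + n) → ℕ) → ∑ g ≡ ∑[ i < m ] g (i ↑ˡ n) + ∑[ j < n ] g (m ↑ʳ j)
∑-split zero    n g = refl
∑-split (suc m) n g = trans (cong (g zero +_) (∑-split m n (g ∘ suc))) (sym (+-assoc (g zero) _ _))

∑∑-split : ∀ m n (g : Fin (m + n) → Fin (m + n) → ℕ) →
           ∑[ x < m + n ] ∑[ y < m + n ] g x y
             ≡ (∑[ i < m ] ∑[ i′ < m ] g (i ↑ˡ n) (i′ ↑ˡ n) + ∑[ i < m ] ∑[ j < n ] g (i ↑ˡ n) (m ↑ʳ j))
             + (∑[ j < n ] ∑[ i < m ] g (m ↑ʳ j) (i ↑ˡ n) + ∑[ j < n ] ∑[ j′ < n ] g (m ↑ʳ j) (m ↑ʳ j′))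
∑∑-split m n g = trans (∑-split m n (λ x → ∑[ y < m + n ] g x y))
  (cong₂ _+_ (trans (sum-cong-≗ (λ i → ∑-split m n (g (i ↑ˡ n))))
                    (∑-distrib-+ (λ i → ∑[ i′ < m ] g (i ↑ˡ n) (i′ ↑ˡ n)) (λ i → ∑[ j < n ] g (i ↑ˡ n) (m ↑ʳ j))))
             (trans (sum-cong-≗ (λ j → ∑-split m n (g (m ↑ʳ j))))
                    (∑-distrib-+ (λ j → ∑[ i < m ] g (m ↑ʳ j) (i ↑ˡ n)) (λ j → ∑[ j′ < n ] g (m ↑ʳ j) (m ↑ʳ j′)))))

suc≟suc : ∀ {n} (k j : Fin n) → ⌊ Fin.suc k ≟ suc j ⌋ ≡ ⌊ k ≟ j ⌋
suc≟suc k j with k ≟ j | suc k ≟ suc j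
... | yes _    | yes _     = refl
... | no  _    | no  _     = refl
... | yes k≡j  | no  sk≢sj = contradiction (cong suc k≡j) sk≢sj
... | no  k≢j  | yes sk≡sj = contradiction (Fin-suc-injective sk≡sj) k≢j

∑-pick : ∀ {n} (k : Fin n) (h : Fin n → ℕ) → ∑[ j < n ] (h j * ind ⌊ k ≟ j ⌋) ≡ h k
∑-pick {suc n} zero    h = trans (cong₂ _+_ (*-identityʳ (h zero))
  (trans (sum-cong-≗ (λ j → *-zeroʳ (h (suc j)))) (sum-replicate-zero n))) (+-identityʳ (h zero))
∑-pick {suc n} (suc k) h = trans (cong₂ _+_ (*-zeroʳ (h zero))
  (sum-cong-≗ (λ j → cong (λ d → h (suc j) * ind d) (suc≟suc k j)))) (∑-pick k (h ∘ suc))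

count : ∀ {n} → (Fin n → Bool) → ℕ
count {n} P = ∑[ i < n ] ind (P i)

degSumP : (G : Graph) → (Fin (V G) → Bool) → ℕ
degSumP G P = ∑[ u < V G ] ∑[ v < V G ] ind (P u ∧ P v ∧ adj G u v)

count-cong : ∀ {n} {P Q : Fin n → Bool} → (∀ i → P i ≡ Q i) → count P ≡ count Q
count-cong P≗Q = sum-cong-≗ (cong ind ∘ P≗Q)

degSumP-cong : ∀ G {P Q : Fin (V G) → Bool} → (∀ i → P i ≡ Q i) → degSumP G P ≡ degSumP G Q
degSumP-cong G P≗Q = sum-cong-≗ λ u → sum-cong-≗ λ v →
  cong₂ (λ x y → ind (x ∧ y ∧ adj G u v)) (P≗Q u) (P≗Q v)

count≤ : ∀ {n} (P : Fin n → Bool) → count P ≤ n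
count≤ {zero}  P = z≤n
count≤ {suc n} P = +-mono-≤ (ind≤1 (P zero)) (count≤ (P ∘ suc))

count≡n⇒full : ∀ {n} (P : Fin n → Bool) → count P ≡ n → ∀ i → P i ≡ true
count≡n⇒full {suc n} P full i with P zero in P0
count≡n⇒full {suc n} P full zero    | true = P0
count≡n⇒full {suc n} P full (suc i) | true = count≡n⇒full (P ∘ suc) (suc-injective full) i
... | false = contradiction (≤-reflexive (sym full)) (<⇒≱ (s≤s (count≤ (P ∘ suc))))

degSumP-empty : ∀ G → degSumP G (λ _ → false) ≡ 0
degSumP-empty G = trans (sum-cong-≗ {V G} {λ u → ∑[ v < V G ] ind (false ∧ false ∧ adj G u v)} {λ _ → 0} (λ _ → sum-replicate-zero (V G)))
                        (sum-replicate-zero (V G))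

∑-allFin : ∀ n (h : Fin n → ℕ) → sum (List.map h (List.allFin n)) ≡ ∑ h
∑-allFin n h = trans (cong sum (map-tabulate (λ i → i) h)) (sum-tabulate h)
  where
  sum-tabulate : ∀ {n} (g : Fin n → ℕ) → sum (List.tabulate g) ≡ ∑ g
  sum-tabulate {zero}  g = refl
  sum-tabulate {suc n} g = cong (g zero +_) (sum-tabulate (g ∘ suc))

degSum≡degSumP : ∀ G X → degSum G X ≡ degSumP G (lookup X)
degSum≡degSumP G X = trans (∑-allFin (V G) _) (sum-cong-≗ λ u → ∑-allFin (V G) (λ v → ind (lookup X u ∧ lookup X v ∧ adj G u v)))

∣∣≡count : ∀ {n} (X : Subset n) → ∣ X ∣ ≡ count (lookup X)
∣∣≡count []          = refl
∣∣≡count (true ∷ X)  = cong suc (∣∣≡count X)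
∣∣≡count (false ∷ X) = ∣∣≡count X

-- Optimal graphs

record Optimal (n : ℕ) (G : Graph) : Set where
  field
    order    : V G ≡ 2 ^ n
    bounded  : ∀ P → degSumP G P ≤ ex n (count P)
    attained : ∀ {m} → m ≤ 2 ^ n → ∃[ P ] count P ≡ m × degSumP G P ≡ ex n m

module _ {G H : Graph} (G≅H : G ≅ H) where
  private
    φ : Fin (V G) ↔ Fin (V H)
    φ = _≅_.φ G≅H
    to : Fin (V G) → Fin (V H)
    to = Inverse.to φ

  count-≅ : ∀ P → count (P ∘ to) ≡ count P
  count-≅ P = sym (sum-permute (ind ∘ P) φ)

  degSumP-≅ : ∀ P → degSumP G (P ∘ to) ≡ degSumP H P
  degSumP-≅ P = begin
    ∑[ u < V G ] ∑[ v < V G ] ind (P (to u) ∧ P (to v) ∧ adj G u v)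
      ≡⟨ sum-cong-≗ (λ u → sum-cong-≗ λ v → cong (λ e → ind (P (to u) ∧ P (to v) ∧ e)) (_≅_.preserves G≅H u v)) ⟩
    ∑[ u < V G ] ∑[ v < V G ] ind (P (to u) ∧ P (to v) ∧ adj H (to u) (to v))
      ≡⟨ sum-cong-≗ (λ u → sum-permute (λ w → ind (P (to u) ∧ P w ∧ adj H (to u) w)) φ) ⟨
    ∑[ u < V G ] ∑[ w < V H ] ind (P (to u) ∧ P w ∧ adj H (to u) w)
      ≡⟨ sum-permute (λ w′ → ∑[ w < V H ] ind (P w′ ∧ P w ∧ adj H w′ w)) φ ⟨
    degSumP H P ∎
    where open ≡-Reasoning

  Optimal-≅ : ∀ {n} → Optimal n H → Optimal n G
  Optimal-≅ {n} opt = record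
    { order    = trans (↔⇒≡ φ) order
    ; bounded  = bound
    ; attained = λ m≤ → let P , count≡ , degSum≡ = attained m≤ in
                 P ∘ to , trans (count-≅ P) count≡ , trans (degSumP-≅ P) degSum≡
    }
    where
    open Optimal opt
    bound : ∀ Q → degSumP G Q ≤ ex n (count Q)
    bound Q = subst₂ _≤_ (sym degSum≡) (cong (ex n) count≡) (bounded Q′)
      where
      Q′ : Fin (V H) → Bool
      Q′ = Q ∘ Inverse.from φ
      Q≗Q′∘to : ∀ u → Q u ≡ Q′ (to u)
      Q≗Q′∘to u = cong Q (sym (inverseˡ φ))
      degSum≡ : degSumP G Q ≡ degSumP H Q′
      degSum≡ = trans (degSumP-cong G Q≗Q′∘to) (degSumP-≅ Q′)
      count≡ : count Q′ ≡ count Q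
      count≡ = trans (sym (count-≅ Q′)) (sym (count-cong Q≗Q′∘to))

module Join (G₀ G₁ : Graph) (σ : Fin (V G₀) ↔ Fin (V G₁)) where
  private
    a b : ℕ
    a = V G₀
    b = V G₁
    s : Fin a → Fin b
    s = Inverse.to σ
    Gσ : Graph
    Gσ = join G₀ G₁ σ

  adj-↑ˡ-↑ˡ : ∀ i i′ → adj Gσ (i ↑ˡ b) (i′ ↑ˡ b) ≡ adj G₀ i i′
  adj-↑ˡ-↑ˡ i i′ rewrite splitAt-↑ˡ a i b | splitAt-↑ˡ a i′ b = refl

  adj-↑ˡ-↑ʳ : ∀ i j → adj Gσ (i ↑ˡ b) (a ↑ʳ j) ≡ ⌊ s i ≟ j ⌋
  adj-↑ˡ-↑ʳ i j rewrite splitAt-↑ˡ a i b | splitAt-↑ʳ a b j = refl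

  adj-↑ʳ-↑ˡ : ∀ j i → adj Gσ (a ↑ʳ j) (i ↑ˡ b) ≡ ⌊ s i ≟ j ⌋
  adj-↑ʳ-↑ˡ j i rewrite splitAt-↑ˡ a i b | splitAt-↑ʳ a b j = refl

  adj-↑ʳ-↑ʳ : ∀ j j′ → adj Gσ (a ↑ʳ j) (a ↑ʳ j′) ≡ adj G₁ j j′
  adj-↑ʳ-↑ʳ j j′ rewrite splitAt-↑ʳ a b j | splitAt-↑ʳ a b j′ = refl

  module _ (P : Fin (a + b) → Bool) where
    left : Fin a → Bool
    left i = P (i ↑ˡ b)

    right : Fin b → Bool
    right j = P (a ↑ʳ j)

    matched : ℕ
    matched = ∑[ i < a ] ind (left i ∧ right (s i))

    count-join : count P ≡ count left + count right
    count-join = ∑-split a b (ind ∘ P)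

    matched≤left : matched ≤ count left
    matched≤left = ∑-mono λ i → ind-∧-≤ˡ (left i) _

    matched≤right : matched ≤ count right
    matched≤right = ≤-trans (∑-mono λ i → ind-∧-≤ʳ (left i) (right (s i))) (≤-reflexive (sym (sum-permute (ind ∘ right) σ)))

    matched-full : (∀ i → left i ≡ true) → matched ≡ count right
    matched-full full = trans (sum-cong-≗ λ i → cong (λ x → ind (x ∧ right (s i))) (full i))
                              (sym (sum-permute (ind ∘ right) σ))

    matching-edges : ∀ i → ∑[ j < b ] ind (left i ∧ right j ∧ ⌊ s i ≟ j ⌋) ≡ ind (left i ∧ right (s i))
    matching-edges i = trans (sum-cong-≗ λ j → trans (cong ind (sym (∧-assoc (left i) (right j) _)))
                                                     (ind-∧ (left i ∧ right j) _))
                             (∑-pick (s i) (λ j → ind (left i ∧ right j)))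

    block-left : ∑[ i < a ] ∑[ i′ < a ] ind (left i ∧ left i′ ∧ adj Gσ (i ↑ˡ b) (i′ ↑ˡ b)) ≡ degSumP G₀ left
    block-left = sum-cong-≗ λ i → sum-cong-≗ λ i′ → cong (λ e → ind (left i ∧ left i′ ∧ e)) (adj-↑ˡ-↑ˡ i i′)

    block-right : ∑[ j < b ] ∑[ j′ < b ] ind (right j ∧ right j′ ∧ adj Gσ (a ↑ʳ j) (a ↑ʳ j′)) ≡ degSumP G₁ right
    block-right = sum-cong-≗ λ j → sum-cong-≗ λ j′ → cong (λ e → ind (right j ∧ right j′ ∧ e)) (adj-↑ʳ-↑ʳ j j′)

    block-left-right : ∑[ i < a ] ∑[ j < b ] ind (left i ∧ right j ∧ adj Gσ (i ↑ˡ b) (a ↑ʳ j)) ≡ matched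
    block-left-right = sum-cong-≗ λ i →
      trans (sum-cong-≗ λ j → cong (λ e → ind (left i ∧ right j ∧ e)) (adj-↑ˡ-↑ʳ i j)) (matching-edges i)

    block-right-left : ∑[ j < b ] ∑[ i < a ] ind (right j ∧ left i ∧ adj Gσ (a ↑ʳ j) (i ↑ˡ b)) ≡ matched
    block-right-left = trans (∑-comm (λ j i → ind (right j ∧ left i ∧ adj Gσ (a ↑ʳ j) (i ↑ˡ b))))
      (sum-cong-≗ λ i → trans (sum-cong-≗ λ j → trans (cong (λ e → ind (right j ∧ left i ∧ e)) (adj-↑ʳ-↑ˡ j i))
                                                      (ind-∧-swap (right j) (left i) _))
                              (matching-edges i))

    degSumP-join : degSumP Gσ P ≡ degSumP G₀ left + degSumP G₁ right + 2 * matched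
    degSumP-join = trans (∑∑-split a b (λ x y → ind (P x ∧ P y ∧ adj Gσ x y)))
      (trans (cong₂ _+_ (cong₂ _+_ block-left block-left-right) (cong₂ _+_ block-right-left block-right))
             (regroup (degSumP G₀ left) matched (degSumP G₁ right)))
      where
      regroup : ∀ x m y → x + m + (m + y) ≡ x + y + 2 * m
      regroup = solve-∀

  glue : (Fin a → Bool) → (Fin b → Bool) → Fin (a + b) → Bool
  glue Q₀ Q₁ x = [ Q₀ , Q₁ ]′ (splitAt a x)

  left-glue : ∀ Q₀ Q₁ i → left (glue Q₀ Q₁) i ≡ Q₀ i
  left-glue Q₀ Q₁ i = cong [ Q₀ , Q₁ ]′ (splitAt-↑ˡ a i b)

  right-glue : ∀ Q₀ Q₁ j → right (glue Q₀ Q₁) j ≡ Q₁ j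
  right-glue Q₀ Q₁ j = cong [ Q₀ , Q₁ ]′ (splitAt-↑ʳ a b j)

  module _ {n} (opt₀ : Optimal n G₀) (opt₁ : Optimal n G₁) where
    private
      module O₀ = Optimal opt₀
      module O₁ = Optimal opt₁

    bounded-join : ∀ P → degSumP Gσ P ≤ ex (suc n) (count P)
    bounded-join P = begin
      degSumP Gσ P
        ≡⟨ degSumP-join P ⟩
      degSumP G₀ (left P) + degSumP G₁ (right P) + 2 * matched P
        ≤⟨ +-mono-≤ (+-mono-≤ (O₀.bounded (left P)) (O₁.bounded (right P)))
                    (*-monoʳ-≤ 2 (⊓-glb (matched≤left P) (matched≤right P))) ⟩
      ex n (count (left P)) + ex n (count (right P)) + 2 * (count (left P) ⊓ count (right P))
        ≤⟨ ex-merge n (count≤2^n (left P) O₀.order) (count≤2^n (right P) O₁.order) ⟩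
      ex (suc n) (count (left P) + count (right P))
        ≡⟨ cong (ex (suc n)) (count-join P) ⟨
      ex (suc n) (count P) ∎
      where
      open ≤-Reasoning
      count≤2^n : ∀ {k} (Q : Fin k → Bool) → k ≡ 2 ^ n → count Q ≤ 2 ^ n
      count≤2^n Q k≡ = subst (count Q ≤_) k≡ (count≤ Q)

    attained-first-half : ∀ {m} → m ≤ 2 ^ n → ∃[ P ] count P ≡ m × degSumP Gσ P ≡ ex (suc n) m
    attained-first-half {m} m≤ with O₀.attained m≤
    ... | Q₀ , count₀ , degSum₀ = P , count≡ , degSum≡
      where
      P : Fin (a + b) → Bool
      P = glue Q₀ (λ _ → false)
      left≗ : ∀ i → left P i ≡ Q₀ i
      left≗ = left-glue Q₀ (λ _ → false)
      right≗ : ∀ j → right P j ≡ false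
      right≗ = right-glue Q₀ (λ _ → false)
      count-right : count (right P) ≡ 0
      count-right = trans (count-cong right≗) (sum-replicate-zero b)
      count≡ : count P ≡ m
      count≡ = begin
        count P                             ≡⟨ count-join P ⟩
        count (left P) + count (right P)    ≡⟨ cong₂ _+_ (trans (count-cong left≗) count₀) count-right ⟩
        m + 0                               ≡⟨ +-identityʳ m ⟩
        m                                   ∎
        where open ≡-Reasoning
      degSum≡ : degSumP Gσ P ≡ ex (suc n) m
      degSum≡ = begin
        degSumP Gσ P                                               ≡⟨ degSumP-join P ⟩
        degSumP G₀ (left P) + degSumP G₁ (right P) + 2 * matched P
          ≡⟨ cong₂ (λ x z → x + 2 * z)
                   (cong₂ _+_ (trans (degSumP-cong G₀ left≗) degSum₀) (trans (degSumP-cong G₁ right≗) (degSumP-empty G₁)))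
                   (n≤0⇒n≡0 (≤-trans (matched≤right P) (≤-reflexive count-right))) ⟩
        ex n m + 0 + 2 * 0                                         ≡⟨ trans (+-identityʳ _) (+-identityʳ _) ⟩
        ex n m                                                     ≡⟨ ex-low n m≤ ⟨
        ex (suc n) m                                               ∎
        where open ≡-Reasoning

    attained-second-half : 2 ≤ n → ∀ {b′} → b′ ≤ 2 ^ n →
                           ∃[ P ] count P ≡ 2 ^ n + b′ × degSumP Gσ P ≡ ex (suc n) (2 ^ n + b′)
    attained-second-half 2≤n {b′} b′≤ with O₀.attained {2 ^ n} ≤-refl | O₁.attained b′≤
    ... | Q₀ , count₀ , degSum₀ | Q₁ , count₁ , degSum₁ = P , count≡ , degSum≡
      where
      P : Fin (a + b) → Bool
      P = glue Q₀ Q₁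
      left≗ : ∀ i → left P i ≡ Q₀ i
      left≗ = left-glue Q₀ Q₁
      right≗ : ∀ j → right P j ≡ Q₁ j
      right≗ = right-glue Q₀ Q₁
      count-left : count (left P) ≡ 2 ^ n
      count-left = trans (count-cong left≗) count₀
      count-right : count (right P) ≡ b′
      count-right = trans (count-cong right≗) count₁
      left-full : ∀ i → left P i ≡ true
      left-full = count≡n⇒full (left P) (trans count-left (sym O₀.order))
      count≡ : count P ≡ 2 ^ n + b′
      count≡ = trans (count-join P) (cong₂ _+_ count-left count-right)
      degSum≡ : degSumP Gσ P ≡ ex (suc n) (2 ^ n + b′)
      degSum≡ = begin
        degSumP Gσ P                                               ≡⟨ degSumP-join P ⟩
        degSumP G₀ (left P) + degSumP G₁ (right P) + 2 * matched P
          ≡⟨ cong₂ (λ x z → x + 2 * z)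
                   (cong₂ _+_ (trans (degSumP-cong G₀ left≗) degSum₀) (trans (degSumP-cong G₁ right≗) degSum₁))
                   (trans (matched-full P left-full) count-right) ⟩
        ex n (2 ^ n) + ex n b′ + 2 * b′                             ≡⟨ ex-high n 2≤n b′≤ ⟨
        ex (suc n) (2 ^ n + b′)                                    ∎
        where open ≡-Reasoning

  Optimal-join : ∀ {n} → 2 ≤ n → Optimal n G₀ → Optimal n G₁ → Optimal (suc n) (join G₀ G₁ σ)
  Optimal-join {n} 2≤n opt₀ opt₁ = record
    { order    = trans (cong₂ _+_ (Optimal.order opt₀) (Optimal.order opt₁)) (sym (2^suc n))
    ; bounded  = bounded-join opt₀ opt₁
    ; attained = attained
    }
    where
    attained : ∀ {m} → m ≤ 2 ^ suc n → ∃[ P ] count P ≡ m × degSumP Gσ P ≡ ex (suc n) m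
    attained {m} m≤ with halve (2 ^ n) (subst (m ≤_) (2^suc n) m≤)
    ... | inj₁ m<                  = attained-first-half opt₀ opt₁ (<⇒≤ m<)
    ... | inj₂ (b′ , b′≤ , refl)   = attained-second-half opt₀ opt₁ 2≤n b′≤

K4-exact-on-vectors : ∀ (X : Vec Bool 4) → degSumP K4 (lookup X) ≡ ex 2 (count (lookup X))
K4-exact-on-vectors (true  ∷ true  ∷ true  ∷ true  ∷ []) = refl
K4-exact-on-vectors (true  ∷ true  ∷ true  ∷ false ∷ []) = refl
K4-exact-on-vectors (true  ∷ true  ∷ false ∷ true  ∷ []) = refl
K4-exact-on-vectors (true  ∷ true  ∷ false ∷ false ∷ []) = refl
K4-exact-on-vectors (true  ∷ false ∷ true  ∷ true  ∷ []) = refl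
K4-exact-on-vectors (true  ∷ false ∷ true  ∷ false ∷ []) = refl
K4-exact-on-vectors (true  ∷ false ∷ false ∷ true  ∷ []) = refl
K4-exact-on-vectors (true  ∷ false ∷ false ∷ false ∷ []) = refl
K4-exact-on-vectors (false ∷ true  ∷ true  ∷ true  ∷ []) = refl
K4-exact-on-vectors (false ∷ true  ∷ true  ∷ false ∷ []) = refl
K4-exact-on-vectors (false ∷ true  ∷ false ∷ true  ∷ []) = refl
K4-exact-on-vectors (false ∷ true  ∷ false ∷ false ∷ []) = refl
K4-exact-on-vectors (false ∷ false ∷ true  ∷ true  ∷ []) = refl
K4-exact-on-vectors (false ∷ false ∷ true  ∷ false ∷ []) = refl
K4-exact-on-vectors (false ∷ false ∷ false ∷ true  ∷ []) = refl
K4-exact-on-vectors (false ∷ false ∷ false ∷ false ∷ []) = refl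

K4-exact : ∀ P → degSumP K4 P ≡ ex 2 (count P)
K4-exact P = begin
  degSumP K4 P                      ≡⟨ degSumP-cong K4 P≗ ⟩
  degSumP K4 (lookup (tabulate P))  ≡⟨ K4-exact-on-vectors (tabulate P) ⟩
  ex 2 (count (lookup (tabulate P))) ≡⟨ cong (ex 2) (count-cong P≗) ⟨
  ex 2 (count P)                    ∎
  where
  open ≡-Reasoning
  P≗ : ∀ i → P i ≡ lookup (tabulate P) i
  P≗ i = sym (lookup∘tabulate P i)

Optimal-K4 : Optimal 2 K4
Optimal-K4 = record
  { order    = refl
  ; bounded  = λ P → ≤-reflexive (K4-exact P)
  ; attained = λ {m} m≤ → initial m , count-initial m≤ , trans (K4-exact (initial m)) (cong (ex 2) (count-initial m≤))
  }
  where
  initial : ℕ → Fin 4 → Bool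
  initial m i = toℕ i <ᵇ m
  count-initial : ∀ {m} → m ≤ 4 → count (initial m) ≡ m
  count-initial {0} _ = refl
  count-initial {1} _ = refl
  count-initial {2} _ = refl
  count-initial {3} _ = refl
  count-initial {4} _ = refl
  count-initial {suc (suc (suc (suc (suc _))))} (s≤s (s≤s (s≤s (s≤s ()))))

InH⇒2≤ : ∀ {n G} → InH n G → 2 ≤ n
InH⇒2≤ (base _ _)               = ≤-refl
InH⇒2≤ (step _ _ _ G₀∈H _ _ _) = m≤n⇒m≤1+n (InH⇒2≤ G₀∈H)

InH⇒Optimal : ∀ {n G} → InH n G → Optimal n G
InH⇒Optimal (base G G≅K4) = Optimal-≅ G≅K4 Optimal-K4
InH⇒Optimal (step G₀ G₁ G G₀∈H G₁∈H σ G≅join) =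
  Optimal-≅ G≅join (Join.Optimal-join G₀ G₁ σ (InH⇒2≤ G₀∈H) (InH⇒Optimal G₀∈H) (InH⇒Optimal G₁∈H))

Optimal⇒IsExm : ∀ {n G m} → Optimal n G → m ≤ 2 ^ n → IsExm G m (ex n m)
Optimal⇒IsExm {n} {G} {m} opt m≤ with Optimal.attained opt m≤
... | P , count≡ , degSum≡ = (tabulate P , ∣X∣≡m , degSumX≡) , bound
  where
  X≗P : ∀ i → lookup (tabulate P) i ≡ P i
  X≗P = lookup∘tabulate P
  ∣X∣≡m : ∣ tabulate P ∣ ≡ m
  ∣X∣≡m = trans (∣∣≡count (tabulate P)) (trans (count-cong X≗P) count≡)
  degSumX≡ : degSum G (tabulate P) ≡ ex n m
  degSumX≡ = trans (degSum≡degSumP G (tabulate P)) (trans (degSumP-cong G X≗P) degSum≡)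
  bound : ∀ Y → ∣ Y ∣ ≡ m → degSum G Y ≤ ex n m
  bound Y ∣Y∣≡m = subst₂ _≤_ (sym (degSum≡degSumP G Y)) (cong (ex n) (trans (sym (∣∣≡count Y)) ∣Y∣≡m))
                         (Optimal.bounded opt (lookup Y))

-- Neither 2 ≤ n (implied by InH) nor 1 ≤ m (the case m = 0 holds too) is needed.
theorem4 : ∀ (n : ℕ) → 2 ≤ n → ∀ (G : Graph) → InH n G →
           ∀ (m : ℕ) → 1 ≤ m → m ≤ 2 ^ n →
           ∀ (ts : List ℕ) → Decreasing ts → sumPow ts ≡ m →
           IsExm G m (f m ts)
theorem4 n _ G G∈H m _ m≤2^n ts ts↓ ts-sum =
  subst (IsExm G m) (sym (f≡ex n ts↓ ts-sum m≤2^n)) (Optimal⇒IsExm (InH⇒Optimal G∈H) m≤2^n)
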